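{- Fix one of the types $\mathrm{B},\mathrm{C},\mathrm{D}$. For every $f\in R$ and every $i\in I$, $$\Phi(\partial_if)=\partial_i\Phi(f),\qquad \Phi(\delta_if)=\delta_i\Phi(f),$$ where on the left $\partial_i,\delta_i$ are the divided difference operators on $R$ and on the right they are the operators on families $\eta=(\eta|_v)_{v\in W}$ given by $$(\partial_i\eta)|_v=\frac{\eta|_v-\eta|_{vs_i}}{ -v(\alpha_i)},\qquad(\delta_i\eta)|_v=\frac{\eta|_v-s_i\big(\eta|_{s_iv}\big)}{\alpha_i}\qquad(v\in W).$$
   Context: $t,z,x$ infinite sequences of indeterminates; $Q_k(x)$ defined by $\prod_i\frac{1+x_iu}{1-x_iu}=\sum_kQ_k(x)u^k$, $P_k=\tfrac12Q_k$, $\Gamma=\mathbb{Z}[Q_1,\dots]$, $\Gamma'=\mathbb{Z}[P_1,\dots]$. Type C: $R=\mathbb{Z}[t]\otimes\mathbb{Z}[z]\otimes\Gamma$; types B, D: $R=\mathbb{Z}[t]\otimes\mathbb{Z}[z]\otimes\Gamma'$. $W_\infty$: finitely supported signed permutations of $\{1,2,\dots\}$ ($w(\bar i)=\overline{w(i)}$), generated by $s_0=(1,\bar1)$, $s_i=(i,i+1)(\bar i,\overline{i+1})$ ($i\ge1$); $W'_\infty$: subgroup with even number of sign changes, generated by $s_{\hat1}=s_0s_1s_0,s_1,s_2,\dots$. Types B, C: $W=W_\infty$, $I=\{0,1,2,\dots\}$; type D: $W=W'_\infty$, $I=\{\hat1,1,2,\dots\}$. $W$ acts on $\mathbb{Z}[t]$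 by $v(t_j)=t_{v(j)}$ with $t_{\bar j}=-t_j$. Actions on $R$ by ring automorphisms: $s_i^z$ ($i\ge1$) swaps $z_i,z_{i+1}$; $s_0^z$: $z_1\mapsto -z_1$, $\varphi(x_1,x_2,\dots)\mapsto\varphi(z_1,x_1,x_2,\dots)$ ($\varphi\in\Gamma'$); $s_i^t$ ($i\ge1$) swaps $t_i,t_{i+1}$; $s_0^t$: $t_1\mapsto-t_1$, $\varphi(x)\mapsto\varphi(-t_1,x_1,x_2,\dots)$; generators not mentioned are fixed; $s_{\hat1}^z=s_0^zs_1^zs_0^z$, $s_{\hat1}^t=s_0^ts_1^ts_0^t$. Simple roots: $\alpha_i=t_{i+1}-t_i$ ($i\ge1$), $\alpha_0=t_1$ (B), $\alpha_0=2t_1$ (C), $\alpha_{\hat1}=t_1+t_2$ (D). $\omega$: ring involution of $R$ with $z_i\mapsto-t_i$, $t_i\mapsto-z_i$, fixing $\Gamma'$. On $R$: $\partial_if=(f-s_i^zf)/\omega(\alpha_i)$, $\delta_if=(f-s_i^tf)/\alpha_i$ (these lie in $R$). For $v\in W$: $t_{v,i}=t_{\overline{v(i)}}$ if $v(i)$ is barred, $0$ otherwise; $\Phi_v:R\to\mathbb{Z}[t]$ is the $\mathbb{Z}[t]$-algebra map $z_i\mapsto t_{v(i)}$, $\varphi(x)\mapsto\varphi(t_{v,1},t_{v,2},\dots)$; $\Phi(f)=(\Phi_v(f))_{v\in W}$. The identities are between elements of $\prod_{v\in W}\mathbb{Q}(t)$. -}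

module Defs where

-- Conventions: all indices are 0-based internally.
-- Variable index j : ℕ stands for the paper's index j+1 (t_{j+1}, z_{j+1}, x_{j+1});
-- positions of Fin n stand for 1..n.

open import Data.Nat as ℕ using (ℕ; zero; suc; _≤_; _<_)
open import Data.Integer using (ℤ; +_; -_; _+_; _*_; _-_; _/ℕ_)
open import Data.Bool using (Bool; true; false; if_then_else_; _xor_)
open import Data.List using (List; []; _∷_; tabulate)
open import Data.Fin as Fin using (Fin; toℕ; fromℕ<)
open import Data.Fin.Permutation using (Permutation′; _⟨$⟩ʳ_; _∘ₚ_; transpose)
import Data.Fin.Permutation as Perm
open import Data.Empty using (⊥)
open import Data.Unit using (⊤)
open import Data.Nat.Properties using (≤-trans; n≤1+n)
open import Relation.Binary.PropositionalEquality using (_≡_)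

data Ty : Set where
  B C D : Ty

-- Q-functions evaluated at finitely many (integer) values x_1,...,x_m
-- (all remaining x_i set to 0).  From
--   prod_i (1+x_i u)/(1-x_i u) = sum_k Q_k(x) u^k  and
--   (1+a u)/(1-a u) = 1 + 2 sum_{j>=1} a^j u^j  we get
--   Q_k(a,x) = Q_k(x) + 2 sum_{j=1}^{k} a^j Q_{k-j}(x),  Q_k() = δ_{k0}.

-- tailSum a q k = sum_{j=1}^{k} a^j q(k-j)
tailSum : ℤ → (ℕ → ℤ) → ℕ → ℤ
tailSum a q zero    = + 0
tailSum a q (suc k) = a * (q k + tailSum a q k)

Qfun : List ℤ → ℕ → ℤ
Qfun []      zero    = + 1
Qfun []      (suc k) = + 0
Qfun (a ∷ r) k       = Qfun r k + (+ 2) * tailSum a (Qfun r) k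

Pfun : List ℤ → ℕ → ℤ
Pfun x k = Qfun x k /ℕ 2

-- Elements of R: polynomial expressions in t_j, z_j and the generators of
-- Γ (type C: gv k = Q_{k+1}) resp. Γ' (types B, D: gv k = P_{k+1}).
-- Two expressions denote the same element of R iff they agree under
-- evaluation at all integer points (t, z, x) with x finitely supported.

data Expr : Set where
  cst : ℤ → Expr
  tv  : ℕ → Expr
  zv  : ℕ → Expr
  gv  : ℕ → Expr
  _⊕_ : Expr → Expr → Expr
  _⊗_ : Expr → Expr → Expr
  ⊖_  : Expr → Expr

record Pt : Set where
  constructor pt
  field
    tp : ℕ → ℤ
    zp : ℕ → ℤ
    xp : List ℤ
open Pt public

gen : Ty → List ℤ → ℕ → ℤ
gen C x k = Qfun x (suc k)
gen B x k = Pfun x (suc k)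
gen D x k = Pfun x (suc k)

eval : Ty → Pt → Expr → ℤ
eval ty p (cst c) = c
eval ty p (tv j)  = tp p j
eval ty p (zv j)  = zp p j
eval ty p (gv k)  = gen ty (xp p) k
eval ty p (e ⊕ f) = eval ty p e + eval ty p f
eval ty p (e ⊗ f) = eval ty p e * eval ty p f
eval ty p (⊖ e)   = - eval ty p e

ω : Expr → Expr
ω (cst c) = cst c
ω (tv j)  = ⊖ zv j
ω (zv j)  = ⊖ tv j
ω (gv k)  = gv k
ω (e ⊕ f) = ω e ⊕ ω f
ω (e ⊗ f) = ω e ⊗ ω f
ω (⊖ e)   = ⊖ ω e

-- Nodes: n0 = s_0, nhat = s_{\hat 1}, ns k = s_{k+1}

data Node : Set where
  n0   : Node
  nhat : Node
  ns   : ℕ → Node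

InI : Ty → Node → Set
InI B nhat = ⊥
InI C nhat = ⊥
InI D n0   = ⊥
InI _ _    = ⊤

α : Ty → Node → Expr
α _ (ns k) = tv (suc k) ⊕ (⊖ tv k)
α B n0     = tv 0
α C n0     = cst (+ 2) ⊗ tv 0
α D n0     = tv 0          -- irrelevant: n0 ∉ I for type D
α _ nhat   = tv 0 ⊕ tv 1

-- The actions s_i^z, s_i^t on R, described on evaluation points:
--   eval (s f) p = eval f (ŝ p).

swapAt : ℕ → (ℕ → ℤ) → ℕ → ℤ
swapAt zero    g zero          = g 1
swapAt zero    g (suc zero)    = g 0
swapAt zero    g (suc (suc j)) = g (suc (suc j))
swapAt (suc k) g zero          = g 0
swapAt (suc k) g (suc j)       = swapAt k (λ m → g (suc m)) j

negFirst : (ℕ → ℤ) → ℕ → ℤ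
negFirst g zero    = - g 0
negFirst g (suc j) = g (suc j)

zAct : Node → Pt → Pt
zAct n0     p = pt (tp p) (negFirst (zp p)) (zp p 0 ∷ xp p)
zAct (ns k) p = pt (tp p) (swapAt k (zp p)) (xp p)
zAct nhat   p = zAct n0 (zAct (ns 0) (zAct n0 p))

tAct : Node → Pt → Pt
tAct n0     p = pt (negFirst (tp p)) (zp p) ((- tp p 0) ∷ xp p)
tAct (ns k) p = pt (swapAt k (tp p)) (zp p) (xp p)
tAct nhat   p = tAct n0 (tAct (ns 0) (tAct n0 p))

-- f ≈ d · g in R, where g = (f - ŝ f)/d : the defining property of the
-- divided difference g (d is a nonzero element of the domain R).
IsDivDiff : Ty → Expr → (Pt → Pt) → Expr → Expr → Set
IsDivDiff ty d act f g =
  ∀ p → eval ty p d * eval ty p g ≡ eval ty p f - eval ty (act p) f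

-- Signed permutations of {1..n} (W_n ⊂ W_∞, extended by the identity):
-- v(j) = perm j, barred iff sgn j = true.

record SP (n : ℕ) : Set where
  constructor sp
  field
    perm : Permutation′ n
    sgn  : Fin n → Bool
open SP public

-- composition u ∘ w  (first w, then u)
_∘w_ : ∀ {n} → SP n → SP n → SP n
u ∘w w = sp (perm w ∘ₚ perm u)
            (λ j → sgn w j xor sgn u (perm w ⟨$⟩ʳ j))

oddSigns : ∀ {n} → (Fin n → Bool) → Bool
oddSigns {zero}  ε = false
oddSigns {suc n} ε = ε Fin.zero xor oddSigns (λ j → ε (Fin.suc j))

-- membership in W (W_∞ for B, C; W'_∞ = even number of sign changes for D)
InW : Ty → ∀ {n} → SP n → Set
InW D v = oddSigns (sgn v) ≡ false
InW _ v = ⊤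

-- number of letters a node moves
need : Node → ℕ
need n0     = 1
need nhat   = 2
need (ns k) = suc (suc k)

isZero : ℕ → Bool
isZero zero    = true
isZero (suc _) = false

below2 : ℕ → Bool
below2 zero          = true
below2 (suc zero)    = true
below2 (suc (suc _)) = false

srefl : (i : Node) {n : ℕ} → need i ≤ n → SP n
srefl n0     le = sp Perm.id (λ j → isZero (toℕ j))
srefl nhat   le = sp (transpose (fromℕ< (≤-trans (n≤1+n 1) le)) (fromℕ< le))
                     (λ j → below2 (toℕ j))
srefl (ns k) le = sp (transpose (fromℕ< (≤-trans (n≤1+n (suc k)) le)) (fromℕ< le))
                     (λ _ → false)

-- Action of W on Z[t] on points: (v·p)(a) = p(actT v a), where
-- (actT v a) j = value of t_{v(j)} (with t_{\bar k} = -t_k).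

signedVal : (ℕ → ℤ) → ℕ → Bool → ℤ
signedVal a k true  = - a k
signedVal a k false = a k

ext : ∀ {n} → (Fin n → ℤ) → (ℕ → ℤ) → ℕ → ℤ
ext {zero}  f g j       = g j
ext {suc n} f g zero    = f Fin.zero
ext {suc n} f g (suc j) = ext (λ i → f (Fin.suc i)) (λ m → g (suc m)) j

actT : ∀ {n} → SP n → (ℕ → ℤ) → ℕ → ℤ
actT v a = ext (λ j → signedVal a (toℕ (perm v ⟨$⟩ʳ j)) (sgn v j)) a

evalT : Ty → Expr → (ℕ → ℤ) → ℤ
evalT ty e a = eval ty (pt a (λ _ → + 0) []) e

-- Φ_v : R → Z[t], evaluated at t = a:
--   z_j ↦ t_{v(j)},  x_j ↦ t_{v,j} (= t_k if v(j) = \bar k, else 0).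
Φ : Ty → ∀ {n} → SP n → Expr → (ℕ → ℤ) → ℤ
Φ ty v f a = eval ty (pt a (actT v a)
                        (tabulate (λ j → if sgn v j then a (toℕ (perm v ⟨$⟩ʳ j)) else + 0)))
                  f

module Submission where

-- Elements of R are compared through their values at points
-- (t, z, x), and Φ_v(f) at t = a is the value of f at the point Φpoint v a.  The
-- defining identity of ∂_i f (resp. δ_i f), evaluated at Φpoint v a, therefore gives
-- the claim as soon as s_i^z (resp. s_i^t) maps Φpoint v a to a point equivalent to
-- Φpoint (v s_i) a (resp. Φpoint (s_i v) (s_i·a)).

open import Defs
open import Data.Nat using (ℕ; _≤_)
open import Data.Integer using (ℤ; -_; _*_; _-_)
open import Data.Product using (_×_)
open import Relation.Binary.PropositionalEquality using (_≡_)

open import Level using (0ℓ)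
open import Data.Nat using (zero; suc; _<_; z≤n; s≤s)
open import Data.Nat.Properties using (≤-trans; n≤1+n; ≮⇒≥; _<?_; ≤⇒≯)
open import Data.Integer using (+_; _+_; _/ℕ_)
open import Data.Integer.Properties using (neg-involutive)
open import Data.Integer.Tactic.RingSolver using (solve-∀)
open import Data.Bool using (Bool; true; false; _xor_; not; if_then_else_)
open import Data.Bool.Properties using (xor-identityʳ)
open import Data.Empty using (⊥-elim)
open import Data.List using (List; _∷_; tabulate)
open import Data.List.Properties using (tabulate-cong)
open import Data.Fin using (Fin; toℕ; fromℕ<)
open import Data.Fin.Properties using (_≟_; suc-injective; toℕ-fromℕ<; toℕ-injective; toℕ<n)
open import Data.Fin.Permutation using (_⟨$⟩ʳ_; _⟨$⟩ˡ_; inverseˡ; inverseʳ)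
import Data.Fin.Permutation.Components as PC
open import Data.Vec.Functional using (updateAt)
open import Data.Vec.Functional.Properties using (updateAt-updates; updateAt-minimal)
open import Data.Product using (_,_; proj₁)
open import Function using (_∘_; const)
open import Relation.Nullary using (Dec; yes; no)
open import Relation.Nullary.Decidable using (dec-true; dec-false)
open import Relation.Binary using (Setoid; IsEquivalence)
open import Relation.Binary.PropositionalEquality
  using (_≢_; _≗_; refl; sym; trans; cong; cong₂; subst; module ≡-Reasoning)
import Relation.Binary.Reasoning.Setoid as SetoidReasoning

-- Multiplying a power series q = Σ q_k u^k by (1+cu)/(1-cu) = 1 + 2 Σ_{j≥1} c^j u^j
-- gives the series (factor c q), where tailSum c q k = Σ_{j=1}^{k} c^j q_{k-j};
-- by definition Qfun (c ∷ L) = factor c (Qfun L).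
factor : ℤ → (ℕ → ℤ) → ℕ → ℤ
factor c q k = q k + + 2 * tailSum c q k

tailSum-cong : ∀ c {q q′ : ℕ → ℤ} → q ≗ q′ → tailSum c q ≗ tailSum c q′
tailSum-cong c q≗q′ zero    = refl
tailSum-cong c q≗q′ (suc k) = cong₂ (λ x y → c * (x + y)) (q≗q′ k) (tailSum-cong c q≗q′ k)

tailSum-zero : ∀ q k → tailSum (+ 0) q k ≡ + 0
tailSum-zero q zero    = refl
tailSum-zero q (suc k) = annihilate (q k + tailSum (+ 0) q k)
  where
  annihilate : ∀ x → + 0 * x ≡ + 0
  annihilate = solve-∀

tailSum-linear : ∀ c (q r : ℕ → ℤ) m k →
                 tailSum c (λ j → q j + m * r j) k ≡ tailSum c q k + m * tailSum c r k
tailSum-linear c q r m zero = base m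
  where
  base : ∀ m → + 0 ≡ + 0 + m * + 0
  base = solve-∀
tailSum-linear c q r m (suc k) rewrite tailSum-linear c q r m k =
  step c (q k) m (r k) (tailSum c q k) (tailSum c r k)
  where
  step : ∀ c x m y s t → c * ((x + m * y) + (s + m * t)) ≡ c * (x + s) + m * (c * (y + t))
  step = solve-∀

-- The induction carries the
-- companion identity c·S_d q = d·S_c q + (d - c)·S_c S_d q, whose series form is
-- c·du/(1-du) - d·cu/(1-cu) = (d-c)·cu/(1-cu)·du/(1-du).
tailSum-comm-and-difference : ∀ c d q k →
  (tailSum c (tailSum d q) k ≡ tailSum d (tailSum c q) k)
  × (c * tailSum d q k ≡ d * tailSum c q k + (d - c) * tailSum c (tailSum d q) k)
tailSum-comm-and-difference c d q zero = refl , base c d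
  where
  base : ∀ c d → c * + 0 ≡ d * + 0 + (d - c) * + 0
  base = solve-∀
tailSum-comm-and-difference c d q (suc k) with tailSum-comm-and-difference c d q k
... | comm , diff rewrite sym comm = commute , difference
  where
  open ≡-Reasoning
  Sc Sd Scd : ℤ
  Sc = tailSum c q k
  Sd = tailSum d q k
  Scd = tailSum c (tailSum d q) k
  commute : c * (Sd + Scd) ≡ d * (Sc + Scd)
  commute = begin
    c * (Sd + Scd)                     ≡⟨ expand c Sd Scd ⟩
    c * Sd + c * Scd                   ≡⟨ cong (_+ c * Scd) diff ⟩
    d * Sc + (d - c) * Scd + c * Scd   ≡⟨ collect c d Sc Scd ⟩
    d * (Sc + Scd)                     ∎
    where
    expand : ∀ c x y → c * (x + y) ≡ c * x + c * y
    expand = solve-∀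
    collect : ∀ c d x y → d * x + (d - c) * y + c * y ≡ d * (x + y)
    collect = solve-∀
  difference : c * (d * (q k + Sd)) ≡ d * (c * (q k + Sc)) + (d - c) * (c * (Sd + Scd))
  difference = begin
    c * (d * (q k + Sd))
      ≡⟨ expand c d (q k) Sd ⟩
    d * (c * q k) + c * (c * Sd) + c * ((d - c) * Sd)
      ≡⟨ cong (λ y → d * (c * q k) + c * y + c * ((d - c) * Sd)) diff ⟩
    d * (c * q k) + c * (d * Sc + (d - c) * Scd) + c * ((d - c) * Sd)
      ≡⟨ collect c d (q k) Sc Sd Scd ⟩
    d * (c * (q k + Sc)) + (d - c) * (c * (Sd + Scd))
      ∎
    where
    expand : ∀ c d x y → c * (d * (x + y)) ≡ d * (c * x) + c * (c * y) + c * ((d - c) * y)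
    expand = solve-∀
    collect : ∀ c d x y z w → d * (c * x) + c * (d * y + (d - c) * w) + c * ((d - c) * z)
                              ≡ d * (c * (x + y)) + (d - c) * (c * (z + w))
    collect = solve-∀

tailSum-comm : ∀ c d q k → tailSum c (tailSum d q) k ≡ tailSum d (tailSum c q) k
tailSum-comm c d q k = proj₁ (tailSum-comm-and-difference c d q k)

-- S_c q + S_{-c} q + 2·S_{-c} S_c q = 0, the tail-sum form of
-- (1+cu)/(1-cu) · (1-cu)/(1+cu) = 1.
tailSum-cancel : ∀ c q k → tailSum c q k + tailSum (- c) q k + + 2 * tailSum (- c) (tailSum c q) k ≡ + 0
tailSum-cancel c q zero    = refl
tailSum-cancel c q (suc k) = begin
  c * (q k + Sc) + (- c) * (q k + Sm) + + 2 * ((- c) * (Sc + Smc))  ≡⟨ regroup c (q k) Sc Sm Smc ⟩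
  (- c) * (Sc + Sm + + 2 * Smc)                                     ≡⟨ cong ((- c) *_) (tailSum-cancel c q k) ⟩
  (- c) * + 0                                                       ≡⟨ vanish c ⟩
  + 0                                                               ∎
  where
  open ≡-Reasoning
  Sc Sm Smc : ℤ
  Sc = tailSum c q k
  Sm = tailSum (- c) q k
  Smc = tailSum (- c) (tailSum c q) k
  regroup : ∀ c x y z w → c * (x + y) + (- c) * (x + z) + + 2 * ((- c) * (y + w))
                          ≡ (- c) * (y + z + + 2 * w)
  regroup = solve-∀
  vanish : ∀ c → (- c) * + 0 ≡ + 0
  vanish = solve-∀

factor-cong : ∀ c {q q′ : ℕ → ℤ} → q ≗ q′ → factor c q ≗ factor c q′
factor-cong c q≗q′ k = cong₂ (λ x y → x + + 2 * y) (q≗q′ k) (tailSum-cong c q≗q′ k)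

factor-zero : ∀ q → factor (+ 0) q ≗ q
factor-zero q k = trans (cong (λ y → q k + + 2 * y) (tailSum-zero q k)) (drop (q k))
  where
  drop : ∀ x → x + + 2 * + 0 ≡ x
  drop = solve-∀

factor-inverse : ∀ c q → factor (- c) (factor c q) ≗ q
factor-inverse c q k = begin
  (q k + + 2 * Sc) + + 2 * tailSum (- c) (factor c q) k
    ≡⟨ cong (λ y → (q k + + 2 * Sc) + + 2 * y) (tailSum-linear (- c) q (tailSum c q) (+ 2) k) ⟩
  (q k + + 2 * Sc) + + 2 * (Sm + + 2 * Smc)    ≡⟨ regroup (q k) Sc Sm Smc ⟩
  q k + + 2 * (Sc + Sm + + 2 * Smc)            ≡⟨ cong (λ y → q k + + 2 * y) (tailSum-cancel c q k) ⟩
  q k + + 2 * + 0                              ≡⟨ drop (q k) ⟩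
  q k                                          ∎
  where
  open ≡-Reasoning
  Sc Sm Smc : ℤ
  Sc = tailSum c q k
  Sm = tailSum (- c) q k
  Smc = tailSum (- c) (tailSum c q) k
  regroup : ∀ x a b e → (x + + 2 * a) + + 2 * (b + + 2 * e) ≡ x + + 2 * (a + b + + 2 * e)
  regroup = solve-∀
  drop : ∀ x → x + + 2 * + 0 ≡ x
  drop = solve-∀

factor-comm : ∀ c d q → factor c (factor d q) ≗ factor d (factor c q)
factor-comm c d q k = begin
  (q k + + 2 * Sd) + + 2 * tailSum c (factor d q) k
    ≡⟨ cong (λ y → (q k + + 2 * Sd) + + 2 * y) (tailSum-linear c q (tailSum d q) (+ 2) k) ⟩
  (q k + + 2 * Sd) + + 2 * (Sc + + 2 * tailSum c (tailSum d q) k)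
    ≡⟨ cong (λ y → (q k + + 2 * Sd) + + 2 * (Sc + + 2 * y)) (tailSum-comm c d q k) ⟩
  (q k + + 2 * Sd) + + 2 * (Sc + + 2 * tailSum d (tailSum c q) k)
    ≡⟨ swap-pairs (q k) Sd Sc (tailSum d (tailSum c q) k) ⟩
  (q k + + 2 * Sc) + + 2 * (Sd + + 2 * tailSum d (tailSum c q) k)
    ≡⟨ cong (λ y → (q k + + 2 * Sc) + + 2 * y) (tailSum-linear d q (tailSum c q) (+ 2) k) ⟨
  (q k + + 2 * Sc) + + 2 * tailSum d (factor c q) k
    ∎
  where
  open ≡-Reasoning
  Sc Sd : ℤ
  Sc = tailSum c q k
  Sd = tailSum d q k
  swap-pairs : ∀ x a b e → (x + + 2 * a) + + 2 * (b + + 2 * e) ≡ (x + + 2 * b) + + 2 * (a + + 2 * e)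
  swap-pairs = solve-∀

-- Two finite lists of values of x are Q-equivalent when all Q_k agree on them;
-- every element of Γ, Γ′ then takes the same value at both.
infix 4 _≋_
record _≋_ (L L′ : List ℤ) : Set where
  constructor mk≋
  field same-Q : ∀ k → Qfun L k ≡ Qfun L′ k
open _≋_

≋-isEquivalence : IsEquivalence _≋_
≋-isEquivalence = record
  { refl  = mk≋ (λ _ → refl)
  ; sym   = λ e → mk≋ (λ k → sym (same-Q e k))
  ; trans = λ e e′ → mk≋ (λ k → trans (same-Q e k) (same-Q e′ k))
  }

≋-setoid : Setoid 0ℓ 0ℓ
≋-setoid = record { Carrier = List ℤ ; _≈_ = _≋_ ; isEquivalence = ≋-isEquivalence }

module ≋-Reasoning = SetoidReasoning ≋-setoid

open IsEquivalence ≋-isEquivalence using () renaming (reflexive to ≋-reflexive; sym to ≋-sym; trans to ≋-trans)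

∷-cong : ∀ c {L L′} → L ≋ L′ → c ∷ L ≋ c ∷ L′
∷-cong c e = mk≋ (factor-cong c (same-Q e))

drop-zero : ∀ L → + 0 ∷ L ≋ L
drop-zero L = mk≋ (factor-zero (Qfun L))

cancel-pair : ∀ c L → - c ∷ c ∷ L ≋ L
cancel-pair c L = mk≋ (factor-inverse c (Qfun L))

swap-head : ∀ c d L → c ∷ d ∷ L ≋ d ∷ c ∷ L
swap-head c d L = mk≋ (factor-comm c d (Qfun L))

-- A common head can be cancelled, by prepending its negative.
∷-cancel : ∀ c {L L′} → c ∷ L ≋ c ∷ L′ → L ≋ L′
∷-cancel c {L} {L′} e = begin
  L               ≈⟨ cancel-pair c L ⟨
  - c ∷ c ∷ L     ≈⟨ ∷-cong (- c) e ⟩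
  - c ∷ c ∷ L′    ≈⟨ cancel-pair c L′ ⟩
  L′              ∎
  where open ≋-Reasoning

-- Exchange: if f and g agree away from position j, then trading the entries at j
-- does not change the multiset, so f j ∷ g ≋ g j ∷ f.
exchange : ∀ {n} (f g : Fin n → ℤ) j → (∀ k → k ≢ j → f k ≡ g k) →
           f j ∷ tabulate g ≋ g j ∷ tabulate f
exchange f g Fin.zero agree = begin
  f zero ∷ g zero ∷ tabulate (g ∘ suc)
    ≡⟨ cong (λ T → f zero ∷ g zero ∷ T) (tabulate-cong (λ k → agree (suc k) λ ())) ⟨
  f zero ∷ g zero ∷ tabulate (f ∘ suc)
    ≈⟨ swap-head (f zero) (g zero) _ ⟩
  g zero ∷ f zero ∷ tabulate (f ∘ suc)
    ∎
  where
  open Data.Fin using (zero; suc)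
  open ≋-Reasoning
exchange f g (Fin.suc j) agree = begin
  f (suc j) ∷ g zero ∷ tabulate (g ∘ suc)
    ≈⟨ swap-head (f (suc j)) (g zero) _ ⟩
  g zero ∷ f (suc j) ∷ tabulate (g ∘ suc)
    ≈⟨ ∷-cong (g zero) (exchange (f ∘ suc) (g ∘ suc) j (λ k k≢j → agree (suc k) (k≢j ∘ suc-injective))) ⟩
  g zero ∷ g (suc j) ∷ tabulate (f ∘ suc)
    ≈⟨ swap-head (g zero) (g (suc j)) _ ⟩
  g (suc j) ∷ g zero ∷ tabulate (f ∘ suc)
    ≡⟨ cong (λ x → g (suc j) ∷ x ∷ tabulate (f ∘ suc)) (agree zero λ ()) ⟨
  g (suc j) ∷ f zero ∷ tabulate (f ∘ suc)
    ∎
  where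
  open Data.Fin using (zero; suc)
  open ≋-Reasoning

transpose-at-i : ∀ {n} (i j : Fin n) → PC.transpose i j i ≡ j
transpose-at-i i j rewrite dec-true (i ≟ i) refl = refl

transpose-at-j : ∀ {n} (i j : Fin n) → PC.transpose i j j ≡ i
transpose-at-j i j with j ≟ i
... | yes j≡i = j≡i
... | no _ rewrite dec-true (j ≟ j) refl = refl

transpose-elsewhere : ∀ {n} (i j k : Fin n) → k ≢ i → k ≢ j → PC.transpose i j k ≡ k
transpose-elsewhere i j k k≢i k≢j rewrite dec-false (k ≟ i) k≢i | dec-false (k ≟ j) k≢j = refl

transpose-involutive : ∀ {n} (i j k : Fin n) → PC.transpose i j (PC.transpose i j k) ≡ k
transpose-involutive i j k = by-cases (k ≟ i) (k ≟ j)
  where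
  by-cases : Dec (k ≡ i) → Dec (k ≡ j) → PC.transpose i j (PC.transpose i j k) ≡ k
  by-cases (yes refl) _ = trans (cong (PC.transpose k j) (transpose-at-i k j)) (transpose-at-j k j)
  by-cases (no _) (yes refl) = trans (cong (PC.transpose i k) (transpose-at-j i k)) (transpose-at-i i k)
  by-cases (no k≢i) (no k≢j) = trans (cong (PC.transpose i j) (transpose-elsewhere i j k k≢i k≢j))
                                     (transpose-elsewhere i j k k≢i k≢j)

-- Proof: with h = f updated at i to f j, two exchanges give
-- f j ∷ f∘(i j) ≋ f i ∷ h ≋ f j ∷ f, and the common head cancels.
tabulate-transpose : ∀ {n} (f : Fin n → ℤ) (i j : Fin n) →
                     tabulate (f ∘ PC.transpose i j) ≋ tabulate f
tabulate-transpose {n} f i j = ∷-cancel (f j) (begin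
  f j ∷ tabulate g   ≡⟨ cong (_∷ tabulate g) h-at-j ⟨
  h j ∷ tabulate g   ≈⟨ exchange h g j h≈g-off-j ⟩
  g j ∷ tabulate h   ≡⟨ cong (_∷ tabulate h) (cong f (transpose-at-j i j)) ⟩
  f i ∷ tabulate h   ≈⟨ exchange f h i (λ k k≢i → sym (updateAt-minimal k i f k≢i)) ⟩
  h i ∷ tabulate f   ≡⟨ cong (_∷ tabulate f) (updateAt-updates i f) ⟩
  f j ∷ tabulate f   ∎)
  where
  open ≋-Reasoning
  g h : Fin n → ℤ
  g = f ∘ PC.transpose i j
  h = updateAt f i (const (f j))
  h-at-j : h j ≡ f j
  h-at-j with j ≟ i
  ... | yes refl = updateAt-updates j f
  ... | no j≢i   = updateAt-minimal j i f j≢i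
  h≈g-off-j : ∀ k → k ≢ j → h k ≡ g k
  h≈g-off-j k k≢j = by-cases (k ≟ i)
    where
    by-cases : Dec (k ≡ i) → h k ≡ g k
    by-cases (yes refl) = trans (updateAt-updates k f) (cong f (sym (transpose-at-i k j)))
    by-cases (no k≢i)   = trans (updateAt-minimal k i f k≢i) (cong f (sym (transpose-elsewhere i j k k≢i k≢j)))

-- Marking a value: position entries of the x-list are either a value y
-- (the position is barred) or 0.
marked : Bool → ℤ → ℤ
marked b y = if b then y else + 0

-- Prepending the value ±y of z_1 to a list headed by the marked y toggles the
-- mark: -y, y cancel and y, 0 reduce to y.
toggle-head : ∀ a K b T → signedVal a K b ∷ marked b (a K) ∷ T ≋ marked (not b) (a K) ∷ T
toggle-head a K true  T = ≋-trans (cancel-pair (a K) T) (≋-sym (drop-zero T))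
toggle-head a K false T = ∷-cong (a K) (drop-zero T)

toggle-at : ∀ {n} y b (f g : Fin n → ℤ) j → (∀ k → k ≢ j → f k ≡ g k) →
            f j ≡ marked b y → g j ≡ (if b then + 0 else - y) →
            - y ∷ tabulate f ≋ tabulate g
toggle-at y true f g j agree fj gj = begin
  - y ∷ tabulate f             ≈⟨ ∷-cong (- y) (drop-zero (tabulate f)) ⟨
  - y ∷ + 0 ∷ tabulate f       ≡⟨ cong (λ x → - y ∷ x ∷ tabulate f) gj ⟨
  - y ∷ g j ∷ tabulate f       ≈⟨ ∷-cong (- y) (exchange f g j agree) ⟨
  - y ∷ f j ∷ tabulate g       ≡⟨ cong (λ x → - y ∷ x ∷ tabulate g) fj ⟩
  - y ∷ y ∷ tabulate g         ≈⟨ cancel-pair y (tabulate g) ⟩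
  tabulate g                   ∎
  where open ≋-Reasoning
toggle-at y false f g j agree fj gj = begin
  - y ∷ tabulate f             ≡⟨ cong (_∷ tabulate f) gj ⟨
  g j ∷ tabulate f             ≈⟨ exchange f g j agree ⟨
  f j ∷ tabulate g             ≡⟨ cong (_∷ tabulate g) fj ⟩
  + 0 ∷ tabulate g             ≈⟨ drop-zero (tabulate g) ⟩
  tabulate g                   ∎
  where open ≋-Reasoning

record _~_ (p q : Pt) : Set where
  constructor mk~
  field
    same-t : tp p ≗ tp q
    same-z : zp p ≗ zp q
    same-x : xp p ≋ xp q
open _~_

~-trans : ∀ {p q r} → p ~ q → q ~ r → p ~ r
~-trans (mk~ t z x) (mk~ t′ z′ x′) = mk~ (λ j → trans (t j) (t′ j)) (λ j → trans (z j) (z′ j)) (≋-trans x x′)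

gen-cong : ∀ ty {L L′} → L ≋ L′ → ∀ k → gen ty L k ≡ gen ty L′ k
gen-cong B e k = cong (_/ℕ 2) (same-Q e (suc k))
gen-cong C e k = same-Q e (suc k)
gen-cong D e k = cong (_/ℕ 2) (same-Q e (suc k))

eval-cong : ∀ ty {p q} → p ~ q → ∀ f → eval ty p f ≡ eval ty q f
eval-cong ty p~q (cst c) = refl
eval-cong ty p~q (tv j)  = same-t p~q j
eval-cong ty p~q (zv j)  = same-z p~q j
eval-cong ty p~q (gv k)  = gen-cong ty (same-x p~q) k
eval-cong ty p~q (f ⊕ g) = cong₂ _+_ (eval-cong ty p~q f) (eval-cong ty p~q g)
eval-cong ty p~q (f ⊗ g) = cong₂ _*_ (eval-cong ty p~q f) (eval-cong ty p~q g)
eval-cong ty p~q (⊖ f)   = cong -_ (eval-cong ty p~q f)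

negFirst-cong : ∀ {h h′ : ℕ → ℤ} → h ≗ h′ → negFirst h ≗ negFirst h′
negFirst-cong e zero    = cong -_ (e 0)
negFirst-cong e (suc j) = e (suc j)

swapAt-cong : ∀ k {h h′ : ℕ → ℤ} → h ≗ h′ → swapAt k h ≗ swapAt k h′
swapAt-cong zero    e zero          = e 1
swapAt-cong zero    e (suc zero)    = e 0
swapAt-cong zero    e (suc (suc j)) = e (suc (suc j))
swapAt-cong (suc k) e zero          = e 0
swapAt-cong (suc k) e (suc j)       = swapAt-cong k (e ∘ suc) j

zAct-cong : ∀ i {p q} → p ~ q → zAct i p ~ zAct i q
zAct-cong n0 {p} (mk~ t z x) =
  mk~ t (negFirst-cong z) (≋-trans (≋-reflexive (cong (_∷ xp p) (z 0))) (∷-cong _ x))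
zAct-cong (ns k) (mk~ t z x) = mk~ t (swapAt-cong k z) x
zAct-cong nhat   p~q = zAct-cong n0 (zAct-cong (ns 0) (zAct-cong n0 p~q))

tAct-cong : ∀ i {p q} → p ~ q → tAct i p ~ tAct i q
tAct-cong n0 {p} (mk~ t z x) =
  mk~ (negFirst-cong t) z (≋-trans (≋-reflexive (cong (λ c → - c ∷ xp p) (t 0))) (∷-cong _ x))
tAct-cong (ns k) (mk~ t z x) = mk~ (swapAt-cong k t) z x
tAct-cong nhat   p~q = tAct-cong n0 (tAct-cong (ns 0) (tAct-cong n0 p~q))

swapAt-at-k : ∀ k h → swapAt k h k ≡ h (suc k)
swapAt-at-k zero    h = refl
swapAt-at-k (suc k) h = swapAt-at-k k (h ∘ suc)

swapAt-at-suc-k : ∀ k h → swapAt k h (suc k) ≡ h k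
swapAt-at-suc-k zero    h = refl
swapAt-at-suc-k (suc k) h = swapAt-at-suc-k k (h ∘ suc)

swapAt-elsewhere : ∀ k h j → j ≢ k → j ≢ suc k → swapAt k h j ≡ h j
swapAt-elsewhere zero    h zero          j≢k _      = ⊥-elim (j≢k refl)
swapAt-elsewhere zero    h (suc zero)    _   j≢sk   = ⊥-elim (j≢sk refl)
swapAt-elsewhere zero    h (suc (suc j)) _   _      = refl
swapAt-elsewhere (suc k) h zero          _   _      = refl
swapAt-elsewhere (suc k) h (suc j)       j≢k j≢sk   =
  swapAt-elsewhere k (h ∘ suc) j (j≢k ∘ cong suc) (j≢sk ∘ cong suc)

ext-inside : ∀ {n} (F : Fin n → ℤ) g (i : Fin n) → ext F g (toℕ i) ≡ F i
ext-inside F g Fin.zero    = refl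
ext-inside F g (Fin.suc i) = ext-inside (F ∘ Fin.suc) (g ∘ suc) i

ext-outside : ∀ {n} (F : Fin n → ℤ) g j → n ≤ j → ext F g j ≡ g j
ext-outside {zero}  F g j       _         = refl
ext-outside {suc n} F g (suc j) (s≤s n≤j) = ext-outside (F ∘ Fin.suc) (g ∘ suc) j n≤j

ext-cong : ∀ {n} {F F′ : Fin n → ℤ} {g g′ : ℕ → ℤ} → F ≗ F′ → (∀ j → n ≤ j → g j ≡ g′ j) →
           ext F g ≗ ext F′ g′
ext-cong {zero}  eF eg j       = eg j z≤n
ext-cong {suc n} eF eg zero    = eF Fin.zero
ext-cong {suc n} eF eg (suc j) = ext-cong (eF ∘ Fin.suc) (λ j n≤j → eg (suc j) (s≤s n≤j)) j

ext-self : ∀ {n} (g : ℕ → ℤ) → ext {n} (g ∘ toℕ) g ≗ g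
ext-self {zero}  g j       = refl
ext-self {suc n} g zero    = refl
ext-self {suc n} g (suc j) = ext-self {n} (g ∘ suc) j

by-position : ∀ {n} (P : ℕ → Set) → (∀ (i : Fin n) → P (toℕ i)) → (∀ j → n ≤ j → P j) → ∀ j → P j
by-position {n} P inside outside j with j <? n
... | yes j<n = subst P (toℕ-fromℕ< j<n) (inside (fromℕ< j<n))
... | no  j≮n = outside j (≮⇒≥ j≮n)

swapAt-ext-inside : ∀ {n} (F : Fin n → ℤ) g (I J : Fin n) → toℕ J ≡ suc (toℕ I) →
                    ∀ i → swapAt (toℕ I) (ext F g) (toℕ i) ≡ F (PC.transpose I J i)
swapAt-ext-inside F g I J J≡sI i = by-cases (i ≟ I) (i ≟ J)
  where
  open ≡-Reasoning
  by-cases : Dec (i ≡ I) → Dec (i ≡ J) → swapAt (toℕ I) (ext F g) (toℕ i) ≡ F (PC.transpose I J i)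
  by-cases (yes refl) _ = begin
    swapAt (toℕ i) (ext F g) (toℕ i)         ≡⟨ swapAt-at-k (toℕ i) (ext F g) ⟩
    ext F g (suc (toℕ i))                    ≡⟨ cong (ext F g) J≡sI ⟨
    ext F g (toℕ J)                          ≡⟨ ext-inside F g J ⟩
    F J                                      ≡⟨ cong F (transpose-at-i i J) ⟨
    F (PC.transpose i J i)                   ∎
  by-cases (no _) (yes refl) = begin
    swapAt (toℕ I) (ext F g) (toℕ i)         ≡⟨ cong (swapAt (toℕ I) (ext F g)) J≡sI ⟩
    swapAt (toℕ I) (ext F g) (suc (toℕ I))   ≡⟨ swapAt-at-suc-k (toℕ I) (ext F g) ⟩
    ext F g (toℕ I)                          ≡⟨ ext-inside F g I ⟩
    F I                                      ≡⟨ cong F (transpose-at-j I i) ⟨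
    F (PC.transpose I i i)                   ∎
  by-cases (no i≢I) (no i≢J) = begin
    swapAt (toℕ I) (ext F g) (toℕ i)         ≡⟨ swapAt-elsewhere (toℕ I) (ext F g) (toℕ i) (i≢I ∘ toℕ-injective)
                                                  (i≢J ∘ toℕ-injective ∘ (λ e → trans e (sym J≡sI))) ⟩
    ext F g (toℕ i)                          ≡⟨ ext-inside F g i ⟩
    F i                                      ≡⟨ cong F (transpose-elsewhere I J i i≢I i≢J) ⟨
    F (PC.transpose I J i)                   ∎

swapAt-ext : ∀ {n} (F : Fin n → ℤ) g k (I J : Fin n) → toℕ I ≡ k → toℕ J ≡ suc k →
             swapAt k (ext F g) ≗ ext (F ∘ PC.transpose I J) g
swapAt-ext {n} F g .(toℕ I) I J refl J≡sI = by-position _ inside outside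
  where
  G : Fin n → ℤ
  G = F ∘ PC.transpose I J
  inside : ∀ i → swapAt (toℕ I) (ext F g) (toℕ i) ≡ ext G g (toℕ i)
  inside i = trans (swapAt-ext-inside F g I J J≡sI i) (sym (ext-inside G g i))
  outside : ∀ j → n ≤ j → swapAt (toℕ I) (ext F g) j ≡ ext G g j
  outside j n≤j = begin
    swapAt (toℕ I) (ext F g) j   ≡⟨ swapAt-elsewhere (toℕ I) (ext F g) j
                                      (λ e → ≤⇒≯ n≤j (subst (_< n) (sym e) (toℕ<n I)))
                                      (λ e → ≤⇒≯ n≤j (subst (_< n) (trans J≡sI (sym e)) (toℕ<n J))) ⟩
    ext F g j                    ≡⟨ ext-outside F g j n≤j ⟩
    g j                          ≡⟨ ext-outside G g j n≤j ⟨
    ext G g j                    ∎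
    where open ≡-Reasoning

negFirst-ext : ∀ {n} (F G : Fin (suc n) → ℤ) g → G Fin.zero ≡ - F Fin.zero →
               (∀ i → G (Fin.suc i) ≡ F (Fin.suc i)) → negFirst (ext F g) ≗ ext G g
negFirst-ext F G g e0 es zero    = sym e0
negFirst-ext F G g e0 es (suc j) = ext-cong (sym ∘ es) (λ _ _ → refl) j

signedVal-not : ∀ a K b → signedVal a K (not b) ≡ - signedVal a K b
signedVal-not a K true  = sym (neg-involutive (a K))
signedVal-not a K false = refl

signedVal-cong : ∀ {a a′ : ℕ → ℤ} {K K′ b b′} → a ≗ a′ → K ≡ K′ → b ≡ b′ →
                 signedVal a K b ≡ signedVal a′ K′ b′
signedVal-cong {b = true}  a≗a′ refl refl = cong -_ (a≗a′ _)
signedVal-cong {b = false} a≗a′ refl refl = a≗a′ _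

signedVal-transport : ∀ (a a′ : ℕ → ℤ) K K′ b c → signedVal a′ K′ c ≡ a K →
                      signedVal a K b ≡ signedVal a′ K′ (b xor c)
signedVal-transport a a′ K K′ true  c e = sym (trans (signedVal-not a′ K′ c) (cong -_ e))
signedVal-transport a a′ K K′ false c e = sym e

-- For a signed permutation v and values a of t, Φ_v sends z_j to the value of
-- t_{v(j)} and x_j to the marked value of t_{|v(j)|} (marked iff v(j) is barred).
zval : ∀ {n} → SP n → (ℕ → ℤ) → Fin n → ℤ
zval v a j = signedVal a (toℕ (perm v ⟨$⟩ʳ j)) (sgn v j)

xval : ∀ {n} → SP n → (ℕ → ℤ) → Fin n → ℤ
xval v a j = marked (sgn v j) (a (toℕ (perm v ⟨$⟩ʳ j)))

-- The evaluation point realising Φ_v: Φ ty v f a = eval ty (Φpoint v a) f by definition.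
Φpoint : ∀ {n} → SP n → (ℕ → ℤ) → Pt
Φpoint v a = pt a (actT v a) (tabulate (xval v a))

module _ {n} (k : ℕ) (le : need (ns k) ≤ n) where
  posI posJ : Fin n
  posI = fromℕ< (≤-trans (n≤1+n (suc k)) le)
  posJ = fromℕ< le

Φpoint-cong : ∀ {n} (u u′ : SP n) {a a′ : ℕ → ℤ} → a ≗ a′ →
              (∀ i → perm u ⟨$⟩ʳ i ≡ perm u′ ⟨$⟩ʳ i) → sgn u ≗ sgn u′ →
              Φpoint u a ~ Φpoint u′ a′
Φpoint-cong u u′ {a′ = a′} a≗a′ same-perm same-sgn =
  mk~ a≗a′
      (ext-cong (λ i → signedVal-cong a≗a′ (cong toℕ (same-perm i)) (same-sgn i)) (λ j _ → a≗a′ j))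
      (≋-reflexive (tabulate-cong λ i →
        cong₂ marked (same-sgn i) (trans (a≗a′ _) (cong (a′ ∘ toℕ) (same-perm i)))))

right-ns : ∀ {n} k (le : need (ns k) ≤ n) (v : SP n) a →
           zAct (ns k) (Φpoint v a) ~ Φpoint (v ∘w srefl (ns k) le) a
right-ns k le v a =
  mk~ (λ _ → refl)
      (swapAt-ext (zval v a) a k (posI k le) (posJ k le) (toℕ-fromℕ< _) (toℕ-fromℕ< le))
      (≋-sym (tabulate-transpose (xval v a) (posI k le) (posJ k le)))

-- s_0 negates z_1, flips the sign of v(1) and so toggles the mark of x_1.
right-n0 : ∀ {n} (le : need n0 ≤ n) (v : SP n) a →
           zAct n0 (Φpoint v a) ~ Φpoint (v ∘w srefl n0 le) a
right-n0 (s≤s z≤n) v a =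
  mk~ (λ _ → refl)
      (negFirst-ext (zval v a) _ a (signedVal-not a K b) (λ _ → refl))
      (toggle-head a K b (tabulate (xval v a ∘ Fin.suc)))
  where
  K : ℕ
  K = toℕ (perm v ⟨$⟩ʳ Fin.zero)
  b : Bool
  b = sgn v Fin.zero

-- s_{\hat 1} = s_0 s_1 s_0, so its case is the composite of the previous two.
right-nhat : ∀ {n} (le : need nhat ≤ n) (v : SP n) a →
             zAct nhat (Φpoint v a) ~ Φpoint (v ∘w srefl nhat le) a
right-nhat {suc (suc m)} le@(s≤s (s≤s z≤n)) v a =
  ~-trans (zAct-cong n0 (~-trans (zAct-cong (ns 0) (right-n0 le₀ v a)) (right-ns 0 le u₁ a)))
          (~-trans (right-n0 le₀ u₂ a)
                   (Φpoint-cong (u₂ ∘w srefl n0 le₀) (v ∘w srefl nhat le) (λ _ → refl) (λ _ → refl) same-sgn))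
  where
  le₀ : need n0 ≤ suc (suc m)
  le₀ = s≤s z≤n
  u₁ u₂ : SP (suc (suc m))
  u₁ = v ∘w srefl n0 le₀
  u₂ = u₁ ∘w srefl (ns 0) le
  same-sgn : sgn (u₂ ∘w srefl n0 le₀) ≗ sgn (v ∘w srefl nhat le)
  same-sgn Fin.zero              = refl
  same-sgn (Fin.suc Fin.zero)    = refl
  same-sgn (Fin.suc (Fin.suc i)) = refl

right-action : ∀ i {n} (le : need i ≤ n) (v : SP n) a →
               zAct i (Φpoint v a) ~ Φpoint (v ∘w srefl i le) a
right-action n0     = right-n0
right-action nhat   = right-nhat
right-action (ns k) = right-ns k

-- s undoes the passage from a to a′ on the first n letters: reading a′ through s
-- gives back a.  Simple reflections are involutions, so s undoes a ↦ actT s a.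
Undoes : ∀ {n} → SP n → (ℕ → ℤ) → (ℕ → ℤ) → Set
Undoes s a′ a = ∀ m → zval s a′ m ≡ a (toℕ m)

actT-left : ∀ {n} (s v : SP n) (a a′ : ℕ → ℤ) → Undoes s a′ a → (∀ j → n ≤ j → a j ≡ a′ j) →
            actT v a ≗ actT (s ∘w v) a′
actT-left s v a a′ undo same-tail = ext-cong zval-same same-tail
  where
  zval-same : zval v a ≗ zval (s ∘w v) a′
  zval-same i = signedVal-transport a a′ _ _ (sgn v i) (sgn s (perm v ⟨$⟩ʳ i)) (undo (perm v ⟨$⟩ʳ i))

actT-outside : ∀ {n} (s : SP n) a j → n ≤ j → a j ≡ actT s a j
actT-outside s a j n≤j = sym (ext-outside (zval s a) a j n≤j)

marked-unbarred : ∀ b {c} {y y′ : ℤ} → c ≡ false → y′ ≡ y → marked b y ≡ marked (b xor c) y′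
marked-unbarred b refl refl = cong (λ b′ → marked b′ _) (sym (xor-identityʳ b))

actT-ns : ∀ {n} k (le : need (ns k) ≤ n) (b : ℕ → ℤ) → swapAt k b ≗ actT (srefl (ns k) le) b
actT-ns {n} k le b j = trans (sym (swapAt-cong k (ext-self {n} b) j))
  (swapAt-ext (b ∘ toℕ) b k (posI k le) (posJ k le) (toℕ-fromℕ< _) (toℕ-fromℕ< le) j)

undoes-ns : ∀ {n} k (le : need (ns k) ≤ n) a → Undoes (srefl (ns k) le) (actT (srefl (ns k) le) a) a
undoes-ns k le a m =
  trans (ext-inside (zval (srefl (ns k) le) a) a _) (cong (a ∘ toℕ) (transpose-involutive _ _ m))

-- Left multiplication by s_{k+1} with t ↦ s_{k+1}·t is the action s_{k+1}^t;
-- no sign changes, so the marks of x stay.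
left-ns : ∀ {n} k (le : need (ns k) ≤ n) (v : SP n) a →
          tAct (ns k) (Φpoint v a) ~ Φpoint (srefl (ns k) le ∘w v) (actT (srefl (ns k) le) a)
left-ns {n} k le v a =
  mk~ (actT-ns k le a)
      (actT-left s v a (actT s a) (undoes-ns k le a) (actT-outside s a))
      (≋-reflexive (tabulate-cong λ i →
        marked-unbarred (sgn v i) refl (undoes-ns k le a (perm v ⟨$⟩ʳ i))))
  where
  s : SP n
  s = srefl (ns k) le

actT-n0 : ∀ {n} (le : need n0 ≤ n) (b : ℕ → ℤ) → negFirst b ≗ actT (srefl n0 le) b
actT-n0           (s≤s z≤n) b zero    = refl
actT-n0 {suc n}   (s≤s z≤n) b (suc j) = sym (ext-self {n} (b ∘ suc) j)

undoes-n0 : ∀ {n} (le : need n0 ≤ n) a → Undoes (srefl n0 le) (actT (srefl n0 le) a) a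
undoes-n0         (s≤s z≤n) a Fin.zero    = neg-involutive (a 0)
undoes-n0 {suc n} (s≤s z≤n) a (Fin.suc m) = ext-inside _ (a ∘ suc) m

-- Under s_0 only the letter j₀ = v⁻¹(1) changes its sign; there the mark of t_1
-- toggles, matching the value -t_1 that s_0^t prepends to x.
left-n0 : ∀ {n} (le : need n0 ≤ n) (v : SP n) a →
          tAct n0 (Φpoint v a) ~ Φpoint (srefl n0 le ∘w v) (actT (srefl n0 le) a)
left-n0 {suc n} le@(s≤s z≤n) v a =
  mk~ (actT-n0 le a)
      (actT-left s v a a′ (undoes-n0 le a) (actT-outside s a))
      (toggle-at (a 0) (sgn v j₀) (xval v a) (xval (s ∘w v) a′) j₀ agree-off-j₀
                 (cong (λ m → marked (sgn v j₀) (a (toℕ m))) v-j₀)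
                 (at-zero (perm v ⟨$⟩ʳ j₀) v-j₀ (sgn v j₀)))
  where
  s : SP (suc n)
  s = srefl n0 le
  a′ : ℕ → ℤ
  a′ = actT s a
  j₀ : Fin (suc n)
  j₀ = perm v ⟨$⟩ˡ Fin.zero
  v-j₀ : perm v ⟨$⟩ʳ j₀ ≡ Fin.zero
  v-j₀ = inverseʳ (perm v)
  at-zero : ∀ m → m ≡ Fin.zero → ∀ b →
            marked (b xor isZero (toℕ m)) (a′ (toℕ m)) ≡ (if b then + 0 else - a 0)
  at-zero .Fin.zero refl true  = refl
  at-zero .Fin.zero refl false = refl
  agree-elsewhere : ∀ m → m ≢ Fin.zero → ∀ b →
                    marked b (a (toℕ m)) ≡ marked (b xor isZero (toℕ m)) (a′ (toℕ m))
  agree-elsewhere Fin.zero     m≢0 b = ⊥-elim (m≢0 refl)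
  agree-elsewhere (Fin.suc m′) _   b = marked-unbarred b refl (undoes-n0 le a (Fin.suc m′))
  agree-off-j₀ : ∀ k → k ≢ j₀ → xval v a k ≡ xval (s ∘w v) a′ k
  agree-off-j₀ k k≢j₀ = agree-elsewhere (perm v ⟨$⟩ʳ k)
    (λ vk≡0 → k≢j₀ (trans (sym (inverseˡ (perm v))) (cong (perm v ⟨$⟩ˡ_) vk≡0))) (sgn v k)

-- Again s_{\hat 1} = s_0 s_1 s_0; the composite agrees with s_{\hat 1} on t and on signs.
left-nhat : ∀ {n} (le : need nhat ≤ n) (v : SP n) a →
            tAct nhat (Φpoint v a) ~ Φpoint (srefl nhat le ∘w v) (actT (srefl nhat le) a)
left-nhat {suc (suc m)} le@(s≤s (s≤s z≤n)) v a =
  ~-trans (tAct-cong n0 (~-trans (tAct-cong (ns 0) (left-n0 le₀ v a)) (left-ns 0 le w₁ a₁)))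
          (~-trans (left-n0 le₀ w₂ a₂)
                   (Φpoint-cong (s₀ ∘w w₂) (srefl nhat le ∘w v) same-values (λ _ → refl)
                                (λ i → same-sgn (perm v ⟨$⟩ʳ i) (sgn v i))))
  where
  le₀ : need n0 ≤ suc (suc m)
  le₀ = s≤s z≤n
  s₀ w₁ w₂ : SP (suc (suc m))
  a₁ a₂ : ℕ → ℤ
  s₀ = srefl n0 le₀
  w₁ = s₀ ∘w v
  a₁ = actT s₀ a
  w₂ = srefl (ns 0) le ∘w w₁
  a₂ = actT (srefl (ns 0) le) a₁
  s₀s₁s₀ : ∀ j → negFirst (swapAt 0 (negFirst a)) j ≡ actT (srefl nhat le) a j
  s₀s₁s₀ zero          = refl
  s₀s₁s₀ (suc zero)    = refl
  s₀s₁s₀ (suc (suc j)) = sym (ext-self {m} (a ∘ suc ∘ suc) j)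
  same-values : actT s₀ a₂ ≗ actT (srefl nhat le) a
  same-values j =
    trans (sym (actT-n0 le₀ a₂ j))
      (trans (negFirst-cong (λ i → sym (actT-ns 0 le a₁ i)) j)
        (trans (negFirst-cong (swapAt-cong 0 (λ i → sym (actT-n0 le₀ a i))) j) (s₀s₁s₀ j)))
  same-sgn : ∀ (x : Fin (suc (suc m))) b →
             ((b xor isZero (toℕ x)) xor false) xor isZero (toℕ (PC.transpose Fin.zero (Fin.suc Fin.zero) x))
               ≡ b xor below2 (toℕ x)
  same-sgn Fin.zero              true  = refl
  same-sgn Fin.zero              false = refl
  same-sgn (Fin.suc Fin.zero)    true  = refl
  same-sgn (Fin.suc Fin.zero)    false = refl
  same-sgn (Fin.suc (Fin.suc x)) true  = refl
  same-sgn (Fin.suc (Fin.suc x)) false = refl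

left-action : ∀ i {n} (le : need i ≤ n) (v : SP n) a →
              tAct i (Φpoint v a) ~ Φpoint (srefl i le ∘w v) (actT (srefl i le) a)
left-action n0     = left-n0
left-action nhat   = left-nhat
left-action (ns k) = left-ns k

neg-double : ∀ x → + 2 * (- x) ≡ - (+ 2 * x)
neg-double = solve-∀

neg-sum : ∀ x y → (- x) + (- y) ≡ - (x + y)
neg-sum = solve-∀

neg-difference : ∀ x y → (- y) + (- - x) ≡ - (y + - x)
neg-difference = solve-∀

ω-root : ∀ ty i → InI ty i → ∀ p → eval ty p (ω (α ty i)) ≡ - evalT ty (α ty i) (zp p)
ω-root B n0     _ p = refl
ω-root C n0     _ p = neg-double (zp p 0)
ω-root D nhat   _ p = neg-sum (zp p 0) (zp p 1)
ω-root B (ns k) _ p = neg-difference (zp p k) (zp p (suc k))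
ω-root C (ns k) _ p = neg-difference (zp p k) (zp p (suc k))
ω-root D (ns k) _ p = neg-difference (zp p k) (zp p (suc k))

root-in-t : ∀ ty i → InI ty i → ∀ p → eval ty p (α ty i) ≡ evalT ty (α ty i) (tp p)
root-in-t B n0     _ p = refl
root-in-t C n0     _ p = refl
root-in-t D nhat   _ p = refl
root-in-t B (ns k) _ p = refl
root-in-t C (ns k) _ p = refl
root-in-t D (ns k) _ p = refl

-- Φ intertwines the divided differences ∂_i: it suffices to evaluate the defining
-- identity of ∂_i f at the point of Φ_v, where s_i^z becomes right multiplication.
Φ-intertwines-∂ : ∀ ty i → InI ty i → ∀ f g → IsDivDiff ty (ω (α ty i)) (zAct i) f g →
                  ∀ {n} (v : SP n) (le : need i ≤ n) a →
                  (- evalT ty (α ty i) (actT v a)) * Φ ty v g a ≡ Φ ty v f a - Φ ty (v ∘w srefl i le) f a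
Φ-intertwines-∂ ty i i∈I f g f≡ωα·g v le a = begin
  (- evalT ty (α ty i) (actT v a)) * Φ ty v g a   ≡⟨ cong (_* Φ ty v g a) (ω-root ty i i∈I (Φpoint v a)) ⟨
  eval ty (Φpoint v a) (ω (α ty i)) * Φ ty v g a  ≡⟨ f≡ωα·g (Φpoint v a) ⟩
  Φ ty v f a - eval ty (zAct i (Φpoint v a)) f     ≡⟨ cong (λ x → Φ ty v f a - x) (eval-cong ty (right-action i le v a) f) ⟩
  Φ ty v f a - Φ ty (v ∘w srefl i le) f a          ∎
  where open ≡-Reasoning

-- Φ intertwines the divided differences δ_i: at the point of Φ_v, s_i^t becomes
-- left multiplication combined with the action of s_i on t.
Φ-intertwines-δ : ∀ ty i → InI ty i → ∀ f h → IsDivDiff ty (α ty i) (tAct i) f h →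
                  ∀ {n} (v : SP n) (le : need i ≤ n) a →
                  evalT ty (α ty i) a * Φ ty v h a ≡ Φ ty v f a - Φ ty (srefl i le ∘w v) f (actT (srefl i le) a)
Φ-intertwines-δ ty i i∈I f h f≡α·h v le a = begin
  evalT ty (α ty i) a * Φ ty v h a                ≡⟨ cong (_* Φ ty v h a) (root-in-t ty i i∈I (Φpoint v a)) ⟨
  eval ty (Φpoint v a) (α ty i) * Φ ty v h a      ≡⟨ f≡α·h (Φpoint v a) ⟩
  Φ ty v f a - eval ty (tAct i (Φpoint v a)) f    ≡⟨ cong (λ x → Φ ty v f a - x) (eval-cong ty (left-action i le v a) f) ⟩
  Φ ty v f a - Φ ty (srefl i le ∘w v) f (actT (srefl i le) a) ∎
  where open ≡-Reasoning

-- Both identities hold for every signed permutation.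
proposition7p4 : (ty : Ty) (i : Node) → InI ty i → (f : Expr) →
    ((g : Expr) → IsDivDiff ty (ω (α ty i)) (zAct i) f g →
      (n : ℕ) (v : SP n) → InW ty v → (le : need i ≤ n) → (a : ℕ → ℤ) →
      (- evalT ty (α ty i) (actT v a)) * Φ ty v g a
        ≡ Φ ty v f a - Φ ty (v ∘w srefl i le) f a)
  × ((h : Expr) → IsDivDiff ty (α ty i) (tAct i) f h →
      (n : ℕ) (v : SP n) → InW ty v → (le : need i ≤ n) → (a : ℕ → ℤ) →
      evalT ty (α ty i) a * Φ ty v h a
        ≡ Φ ty v f a - Φ ty (srefl i le ∘w v) f (actT (srefl i le) a))
proposition7p4 ty i i∈I f =
    (λ g ∂f _ v _ le a → Φ-intertwines-∂ ty i i∈I f g ∂f v le a)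
  , (λ h δf _ v _ le a → Φ-intertwines-δ ty i i∈I f h δf v le a)
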